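{- Let $q$ be a prime power and $n,k,\delta,s$ positive integers with $n\geq 2k$ and $s\ge\delta$. Suppose there exists an $(n,M_1,2\delta,k)_q$-CDC constructed via the multilevel construction such that every one of its identifying vectors $\boldsymbol v=(\boldsymbol v^{(1)}\mid \boldsymbol v^{(2)})$, with $\boldsymbol v^{(1)}$ of length $n-k$ and $\boldsymbol v^{(2)}$ of length $k$, satisfies $\mathrm{wt}(\boldsymbol v^{(1)})\geq s$. If there exists a $(k\times (n-k),M_2,\delta,[0,s-\delta])_q$-GRMC, then there exists an $(n,M_1+M_2,2\delta,k)_q$-CDC.
   Context: $\mathcal G_q(n,k)$ is the set of $k$-dimensional subspaces of $\mathbb F_q^n$, with subspace distance $d_S(\mathcal U,\mathcal V)=\dim\mathcal U+\dim\mathcal V-2\dim(\mathcal U\cap\mathcal V)$; an $(n,M,d,k)_q$-CDC is a set of $M$ elements of $\mathcal G_q(n,k)$ with pairwise subspace distance at least $d$. $\mathrm{wt}$ denotes Hamming weight. For a binary vector $\boldsymbol v$ of length $n$ and weight $k$, its echelon Ferrers form $EF(\boldsymbol v)$ is the $k\times n$ matrix in reduced row echelon form whose leading ones lie in the columns where $\boldsymbol v$ has ones, with a free position ("dot") at every entry that is not forced to be $0$ or $1$ by this (i.e. entries to the right of the row's leading one in non-pivot columns); the dots form a Ferrers diagram $\mathcal F_{\boldsymbol v}$. A Ferrers diagram rank-metric code in $\mathcal F_{\boldsymbol v}$ with minimum rank distance $\delta$ is an $\mathbb F_q$-linear space of matrices supported on the dot positions whose nonzero elements have rank at least $\delta$.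 The multilevel construction: take a set $\mathcal A$ of binary vectors of length $n$, weight $k$ and pairwise Hamming distance at least $2\delta$ (the identifying vectors), and for each $\boldsymbol v\in\mathcal A$ such a Ferrers diagram rank-metric code $\mathcal D_{\boldsymbol v}$; the code is the set of row spaces of all matrices obtained from $EF(\boldsymbol v)$ by filling the dots with a codeword of $\mathcal D_{\boldsymbol v}$, over all $\boldsymbol v\in\mathcal A$; it is an $(n,2\delta,k)_q$-CDC. A $(k\times(n-k),M,\delta,K)_q$-GRMC is a set of $M$ matrices in $\mathbb F_q^{k\times(n-k)}$, each of rank in $K$, with pairwise rank distance $\mathrm{rank}(\boldsymbol D_1-\boldsymbol D_2)\ge\delta$; $[a,b]$ is the set of integers $x$ with $a\le x\le b$. -}

module Defs where

open import Level using (0ℓ)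
open import Data.Nat using (ℕ; zero; suc; _+_; _*_; _∸_; _^_; _≤_; _<_; _<ᵇ_; _≡ᵇ_)
open import Data.Nat.Primality using (Prime)
open import Data.Fin using (Fin; toℕ) renaming (zero to fzero; suc to fsuc)
open import Data.Bool using (Bool; true; false; _∧_; _xor_; if_then_else_)
open import Data.Product using (Σ; ∃; _×_; _,_)
open import Relation.Binary.PropositionalEquality using (_≡_; _≢_)
open import Relation.Nullary using (¬_)
open import Function using (_∘_)
open import Function.Bundles using (_↔_)
open import Algebra.Structures using (IsCommutativeRing)

IsPrimePower : ℕ → Set
IsPrimePower q = Σ ℕ λ p → Σ ℕ λ m → Prime p × 1 ≤ m × q ≡ p ^ m

record FiniteField (q : ℕ) : Set₁ where
  infixl 6 _+ᶠ_
  infixl 7 _*ᶠ_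
  field
    Carrier : Set
    _+ᶠ_ _*ᶠ_ : Carrier → Carrier → Carrier
    -ᶠ_      : Carrier → Carrier
    0# 1#   : Carrier
    isCommutativeRing : IsCommutativeRing _≡_ _+ᶠ_ _*ᶠ_ -ᶠ_ 0# 1#
    0≢1     : 0# ≢ 1#
    inverse : ∀ x → x ≢ 0# → Σ Carrier λ y → x *ᶠ y ≡ 1#
    enumeration : Carrier ↔ Fin q

BVec : ℕ → Set
BVec n = Fin n → Bool

count : ∀ {n} → (Fin n → Bool) → ℕ
count {zero}  f = 0
count {suc n} f = (if f fzero then 1 else 0) + count (f ∘ fsuc)

wt : ∀ {n} → BVec n → ℕ
wt = count

-- number of ones of v in positions 0 .. m-1 (0-indexed);
-- wt (v^(1)) for the prefix v^(1) of length m is  onesBefore v m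
onesBefore : ∀ {n} → BVec n → ℕ → ℕ
onesBefore v m = count (λ j → v j ∧ (toℕ j <ᵇ m))

dH : ∀ {n} → BVec n → BVec n → ℕ
dH v w = count (λ j → v j xor w j)

-- (i , j) is a dot of the Ferrers diagram F_v of EF(v) (k × n, 0-indexed rows
-- and columns): column j is not a pivot column, and the pivot of row i
-- (the (i+1)-st one of v) lies strictly left of j, i.e. more than i ones of v
-- occur before column j.
IsDot : ∀ {n k} → BVec n → Fin k → Fin n → Set
IsDot v i j = v j ≡ false × toℕ i < onesBefore v (toℕ j)

sumFin : ∀ {a} → (Fin a → ℕ) → ℕ
sumFin {zero}  f = 0
sumFin {suc a} f = f fzero + sumFin (f ∘ fsuc)

module LinAlg {q : ℕ} (F : FiniteField q) where
  open FiniteField F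

  Vec : ℕ → Set
  Vec n = Fin n → Carrier

  Matrix : ℕ → ℕ → Set
  Matrix r c = Fin r → Fin c → Carrier

  _≈_ : ∀ {n} → Vec n → Vec n → Set
  v ≈ w = ∀ j → v j ≡ w j

  _≈M_ : ∀ {r c} → Matrix r c → Matrix r c → Set
  A ≈M B = ∀ i j → A i j ≡ B i j

  zeroV : ∀ {n} → Vec n
  zeroV _ = 0#

  zeroM : ∀ {r c} → Matrix r c
  zeroM _ _ = 0#

  _+M_ : ∀ {r c} → Matrix r c → Matrix r c → Matrix r c
  (A +M B) i j = A i j +ᶠ B i j

  _-M_ : ∀ {r c} → Matrix r c → Matrix r c → Matrix r c
  (A -M B) i j = A i j +ᶠ (-ᶠ B i j)

  _·M_ : ∀ {r c} → Carrier → Matrix r c → Matrix r c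
  (x ·M A) i j = x *ᶠ A i j

  lincomb : ∀ {m n} → (Fin m → Carrier) → (Fin m → Vec n) → Vec n
  lincomb {zero}  c B j = 0#
  lincomb {suc m} c B j = c fzero *ᶠ B fzero j +ᶠ lincomb (c ∘ fsuc) (B ∘ fsuc) j

  InSpan : ∀ {m n} → (Fin m → Vec n) → Vec n → Set
  InSpan {m} B v = Σ (Fin m → Carrier) λ c → lincomb c B ≈ v

  LinIndep : ∀ {m n} → (Fin m → Vec n) → Set
  LinIndep B = ∀ c → lincomb c B ≈ zeroV → ∀ i → c i ≡ 0#

  Subset : ℕ → Set₁
  Subset n = Vec n → Set

  HasDim : ∀ {n} → Subset n → ℕ → Set
  HasDim {n} U d = Σ (Fin d → Vec n) λ B →
    LinIndep B × (∀ v → (U v → InSpan B v) × (InSpan B v → U v))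

  _∩_ : ∀ {n} → Subset n → Subset n → Subset n
  (U ∩ V) v = U v × V v

  -- subspace distance d_S(U,V) = dim U + dim V - 2 dim(U ∩ V) is at least d
  dS≥ : ∀ {n} → Subset n → Subset n → ℕ → Set
  dS≥ U V d = Σ ℕ λ a → Σ ℕ λ b → Σ ℕ λ c →
    HasDim U a × HasDim V b × HasDim (U ∩ V) c × d + 2 * c ≤ a + b

  RowSpace : ∀ {r c} → Matrix r c → Subset c
  RowSpace A = InSpan A

  HasRank : ∀ {r c} → Matrix r c → ℕ → Set
  HasRank A ρ = HasDim (RowSpace A) ρ

  RankIn : ∀ {r c} → Matrix r c → ℕ → ℕ → Set
  RankIn A lo hi = Σ ℕ λ ρ → HasRank A ρ × lo ≤ ρ × ρ ≤ hi

  RankAtLeast : ∀ {r c} → Matrix r c → ℕ → Set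
  RankAtLeast A δ = Σ ℕ λ ρ → HasRank A ρ × δ ≤ ρ

  CDC : (n M d k : ℕ) → Set₁
  CDC n M d k = Σ (Fin M → Subset n) λ C →
    (∀ i → HasDim (C i) k) × (∀ i j → i ≢ j → dS≥ (C i) (C j) d)

  GRMC : (r c M δ lo hi : ℕ) → Set
  GRMC r c M δ lo hi = Σ (Fin M → Matrix r c) λ D →
    (∀ i → RankIn (D i) lo hi) ×
    (∀ i j → i ≢ j → RankAtLeast (D i -M D j) δ)

  record FerrersCode {n k : ℕ} (v : BVec n) (m δ : ℕ) : Set where
    field
      word       : Fin m → Matrix k n
      distinct   : ∀ i j → i ≢ j → ¬ (word i ≈M word j)
      supported  : ∀ l i j → ¬ IsDot v i j → word l i j ≡ 0#
      closed-+   : ∀ l l′ → Σ (Fin m) λ l″ → word l″ ≈M (word l +M word l′)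
      closed-·   : ∀ x l → Σ (Fin m) λ l″ → word l″ ≈M (x ·M word l)
      contains-0 : Σ (Fin m) λ l → word l ≈M zeroM
      minRank    : ∀ l → ¬ (word l ≈M zeroM) → RankAtLeast (word l) δ

  -- Data of the multilevel construction of an (n, M, 2δ, k)_q-CDC:
  -- identifying vectors A (length n, weight k, pairwise Hamming distance
  -- ≥ 2δ) and for each v ∈ A a Ferrers diagram rank-metric code D_v; the
  -- resulting code has M = Σ_v |D_v| codewords.
  record MultilevelCDC (n M δ k s : ℕ) : Set where
    field
      a        : ℕ
      idVec    : Fin a → BVec n
      weight   : ∀ i → wt (idVec i) ≡ k
      hamming  : ∀ i j → i ≢ j → 2 * δ ≤ dH (idVec i) (idVec j)
      size     : Fin a → ℕ
      code     : ∀ i → FerrersCode {n} {k} (idVec i) (size i) δ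
      total    : M ≡ sumFin size
      prefixWt : ∀ i → s ≤ onesBefore (idVec i) (n ∸ k)

    -- EF(v) filled with a codeword: the leading one of row r sits in the
    -- column j with v j = 1 preceded by exactly r ones of v.
    -- the codewords of the CDC are the row spaces RowSpace (filled i l).
    filled : (i : Fin a) → Fin (size i) → Matrix k n
    filled i l r j =
      (if v j ∧ (onesBefore v (toℕ j) ≡ᵇ toℕ r) then 1# else 0#)
      +ᶠ FerrersCode.word (code i) l r j
      where v = idVec i

-- The new code adds to the multilevel code the row spaces of the lifted matrices (D | I_k), D in the
-- rank-metric code. Subspace distance ≥ 2δ between two k-dimensional row spaces means that every family of
-- independent vectors common to both has at most k − δ members.
-- Two codewords with the same identifying vector, or two lifted matrices, have their pivots in the same
-- columns, so a common vector has the same coefficients in both, and these lie in the left kernel of the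
-- difference of the two fillings, which has rank ≥ δ.
-- For distinct identifying vectors v, w, a common vector is determined by its entries where both v and w
-- have ones (induct over the pivots from left to right), and there are at most k − δ such positions since
-- d_H(v, w) ≥ 2δ.
-- For a multilevel codeword with identifying vector v and a lifted matrix (D | I_k), a common vector is
-- determined by its entries at the pivots of v among the last k columns, at most k − s of them because
-- wt(v⁽¹⁾) ≥ s, together with its first n − k entries, which lie in the row space of D, of dimension at
-- most s − δ.
module Submission where

open import Algebra.Bundles using (CommutativeRing)
import Algebra.Properties.AbelianGroup
import Algebra.Properties.CommutativeSemigroup
import Algebra.Properties.Ring
import Algebra.Properties.Semiring.Sum
open import Data.Bool using (Bool; true; false; _∧_; _∨_; _xor_; not; if_then_else_)
open import Data.Empty using (⊥-elim)
open import Data.Fin using (Fin; toℕ; fromℕ<; cast; splitAt; join; _↑ˡ_; _↑ʳ_; punchIn)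
  renaming (zero to fzero; suc to fsuc)
import Data.Fin.Properties as Fin
open import Data.Nat using (ℕ; zero; suc; _+_; _*_; _∸_; _≤_; _<_; _<ᵇ_; _≡ᵇ_; z≤n; s≤s)
import Data.Nat.Properties as ℕ
open import Data.Nat.Tactic.RingSolver using (solve-∀)
open import Data.Product using (Σ; ∃; _×_; _,_; proj₁; proj₂)
open import Data.Sum using (_⊎_; inj₁; inj₂)
open import Data.Vec.Functional using (insertAt; _∷_; head; tail; _++_)
import Data.Vec.Functional.Properties as Vector
open import Function using (_∘_; _$_; const)
open import Function.Bundles using (Inverse)
open import Function.Properties.Inverse using (↔⇒↣)
open import Relation.Binary.PropositionalEquality
open import Relation.Nullary using (¬_; ¬?; Dec; yes; no; _×-dec_)
open import Relation.Nullary.Decidable using (decidable-stable)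

open import Defs

open Algebra.Properties.CommutativeSemigroup ℕ.+-commutativeSemigroup
  using () renaming (interchange to +-interchange)

≡ᵇ-refl : ∀ n → (n ≡ᵇ n) ≡ true
≡ᵇ-refl zero    = refl
≡ᵇ-refl (suc n) = ≡ᵇ-refl n

≢⇒≡ᵇ≡false : ∀ m n → m ≢ n → (m ≡ᵇ n) ≡ false
≢⇒≡ᵇ≡false zero    zero    m≢n = ⊥-elim (m≢n refl)
≢⇒≡ᵇ≡false zero    (suc n) m≢n = refl
≢⇒≡ᵇ≡false (suc m) zero    m≢n = refl
≢⇒≡ᵇ≡false (suc m) (suc n) m≢n = ≢⇒≡ᵇ≡false m n (m≢n ∘ cong suc)

≡ᵇ-comm : ∀ m n → (m ≡ᵇ n) ≡ (n ≡ᵇ m)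
≡ᵇ-comm zero    zero    = refl
≡ᵇ-comm zero    (suc n) = refl
≡ᵇ-comm (suc m) zero    = refl
≡ᵇ-comm (suc m) (suc n) = ≡ᵇ-comm m n

≮⇒<ᵇ≡false : ∀ m n → ¬ m < n → (m <ᵇ n) ≡ false
≮⇒<ᵇ≡false m       zero    m≮n = refl
≮⇒<ᵇ≡false zero    (suc n) m≮n = ⊥-elim (m≮n (s≤s z≤n))
≮⇒<ᵇ≡false (suc m) (suc n) m≮n = ≮⇒<ᵇ≡false m n (m≮n ∘ s≤s)

half-≤ : ∀ a b → a + a ≤ b + b → a ≤ b
half-≤ a b a+a≤b+b = ℕ.*-cancelˡ-≤ 2 (subst₂ _≤_ (double a) (double b) a+a≤b+b)
  where
  double : ∀ x → x + x ≡ 2 * x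
  double x = cong (x +_) (sym (ℕ.+-identityʳ x))

bit : Bool → ℕ
bit b = if b then 1 else 0

count-+ : ∀ {n} (f g h e : Fin n → Bool) →
  (∀ j → bit (f j) + bit (g j) ≡ bit (h j) + bit (e j)) → count f + count g ≡ count h + count e
count-+ {zero}  f g h e p = refl
count-+ {suc n} f g h e p = begin
  (bit (f fzero) + count (f ∘ fsuc)) + (bit (g fzero) + count (g ∘ fsuc))
    ≡⟨ +-interchange (bit (f fzero)) _ _ _ ⟩
  (bit (f fzero) + bit (g fzero)) + (count (f ∘ fsuc) + count (g ∘ fsuc))
    ≡⟨ cong₂ _+_ (p fzero) (count-+ _ _ _ _ (p ∘ fsuc)) ⟩
  (bit (h fzero) + bit (e fzero)) + (count (h ∘ fsuc) + count (e ∘ fsuc))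
    ≡⟨ +-interchange (bit (h fzero)) _ _ _ ⟩
  (bit (h fzero) + count (h ∘ fsuc)) + (bit (e fzero) + count (e ∘ fsuc)) ∎
  where open ≡-Reasoning

count-false : ∀ {n} → count {n} (const false) ≡ 0
count-false {zero}  = refl
count-false {suc n} = count-false {n}

count-+-count-false : ∀ {n} (f : Fin n → Bool) → count f + count {n} (const false) ≡ count f
count-+-count-false {n} f = trans (cong (count f +_) (count-false {n})) (ℕ.+-identityʳ _)

wt+wt≡count∧+count∧+dH : ∀ {n} (v w : BVec n) →
  wt v + wt w ≡ count (λ j → v j ∧ w j) + (count (λ j → v j ∧ w j) + dH v w)
wt+wt≡count∧+count∧+dH v w = begin
  count v + count w                                     ≡⟨ count-+ v w _ _ (λ j → ∧∨ (v j) (w j)) ⟩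
  count (λ j → v j ∧ w j) + count (λ j → v j ∨ w j)      ≡⟨ cong (count (λ j → v j ∧ w j) +_) ∨≡∧+xor ⟩
  count (λ j → v j ∧ w j) + (count (λ j → v j ∧ w j) + dH v w) ∎
  where
  open ≡-Reasoning
  ∧∨ : ∀ a b → bit a + bit b ≡ bit (a ∧ b) + bit (a ∨ b)
  ∧∨ true  true  = refl
  ∧∨ true  false = refl
  ∧∨ false true  = refl
  ∧∨ false false = refl
  ∨∧xor : ∀ a b → bit (a ∨ b) + bit false ≡ bit (a ∧ b) + bit (a xor b)
  ∨∧xor true  true  = refl
  ∨∧xor true  false = refl
  ∨∧xor false true  = refl
  ∨∧xor false false = refl
  ∨≡∧+xor : count (λ j → v j ∨ w j) ≡ count (λ j → v j ∧ w j) + dH v w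
  ∨≡∧+xor = trans (sym (count-+-count-false (λ j → v j ∨ w j))) (count-+ _ _ _ _ (λ j → ∨∧xor (v j) (w j)))

wt≡onesFrom+onesBefore : ∀ {n} (v : BVec n) m →
  wt v ≡ count (λ j → v j ∧ not (toℕ j <ᵇ m)) + onesBefore v m
wt≡onesFrom+onesBefore v m =
  trans (sym (count-+-count-false v)) (count-+ _ _ _ _ (λ j → split (v j) (toℕ j <ᵇ m)))
  where
  split : ∀ a b → bit a + bit false ≡ bit (a ∧ not b) + bit (a ∧ b)
  split true  true  = refl
  split true  false = refl
  split false true  = refl
  split false false = refl

commonOnes+δ≤k : ∀ {n k δ} (v w : BVec n) → wt v ≡ k → wt w ≡ k → 2 * δ ≤ dH v w →
  count (λ j → v j ∧ w j) + δ ≤ k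
commonOnes+δ≤k {k = k} {δ} v w wt-v wt-w 2δ≤dH = half-≤ _ k (begin
  (S + δ) + (S + δ)   ≡⟨ rearrange S δ ⟩
  S + (S + 2 * δ)     ≤⟨ ℕ.+-monoʳ-≤ S (ℕ.+-monoʳ-≤ S 2δ≤dH) ⟩
  S + (S + dH v w)    ≡⟨ wt+wt≡count∧+count∧+dH v w ⟨
  wt v + wt w         ≡⟨ cong₂ _+_ wt-v wt-w ⟩
  k + k               ∎)
  where
  open ℕ.≤-Reasoning
  S : ℕ
  S = count (λ j → v j ∧ w j)
  rearrange : ∀ x y → (x + y) + (x + y) ≡ x + (x + 2 * y)
  rearrange = solve-∀

onesBefore-zero : ∀ {n} (v : BVec n) → onesBefore v 0 ≡ 0
onesBefore-zero {zero}  v = refl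
onesBefore-zero {suc n} v with v fzero
... | true  = onesBefore-zero (v ∘ fsuc)
... | false = onesBefore-zero (v ∘ fsuc)

onesBefore-suc : ∀ {n} (v : BVec (suc n)) m →
  onesBefore v (suc m) ≡ bit (v fzero) + onesBefore (v ∘ fsuc) m
onesBefore-suc v m with v fzero
... | true  = refl
... | false = refl

onesBefore-mono : ∀ {n} (v : BVec n) {a b} → a ≤ b → onesBefore v a ≤ onesBefore v b
onesBefore-mono {zero}  v         le      = z≤n
onesBefore-mono {suc n} v {zero}  le      rewrite onesBefore-zero v = z≤n
onesBefore-mono {suc n} v {suc a} {suc b} (s≤s le) rewrite onesBefore-suc v a | onesBefore-suc v b =
  ℕ.+-monoʳ-≤ (bit (v fzero)) (onesBefore-mono (v ∘ fsuc) le)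

pivot : ∀ {n} (v : BVec n) r → r < wt v →
  Σ (Fin n) λ j → v j ≡ true × onesBefore v (toℕ j) ≡ r
pivot {suc n} v r r<wt = go (v fzero) refl r r<wt
  where
  later : ∀ {b r} → v fzero ≡ b →
    Σ (Fin n) (λ j → v (fsuc j) ≡ true × onesBefore (v ∘ fsuc) (toℕ j) ≡ r) →
    Σ (Fin (suc n)) λ j → v j ≡ true × onesBefore v (toℕ j) ≡ bit b + r
  later v₀ (j , vj , ob) = fsuc j , vj , trans (onesBefore-suc v (toℕ j)) (cong₂ _+_ (cong bit v₀) ob)
  go : ∀ b → v fzero ≡ b → ∀ r → r < bit b + wt (v ∘ fsuc) →
    Σ (Fin (suc n)) λ j → v j ≡ true × onesBefore v (toℕ j) ≡ r
  go true  v₀ zero    _            = fzero , v₀ , onesBefore-zero v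
  go true  v₀ (suc r) (s≤s r<wt)   = later v₀ (pivot (v ∘ fsuc) r r<wt)
  go false v₀ r       r<wt         = later v₀ (pivot (v ∘ fsuc) r r<wt)

rowPivot : ∀ {n k} (v : BVec n) → wt v ≡ k → (r : Fin k) →
  Σ (Fin n) λ j → v j ≡ true × onesBefore v (toℕ j) ≡ toℕ r
rowPivot v wt≡k r = pivot v (toℕ r) (subst (toℕ r <_) (sym wt≡k) (Fin.toℕ<n r))

pivotCol : ∀ {n k} (v : BVec n) → wt v ≡ k → Fin k → Fin n
pivotCol v wt≡k = proj₁ ∘ rowPivot v wt≡k

pivotCol-one : ∀ {n k} (v : BVec n) (wt≡k : wt v ≡ k) r → v (pivotCol v wt≡k r) ≡ true
pivotCol-one v wt≡k = proj₁ ∘ proj₂ ∘ rowPivot v wt≡k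

pivotCol-rank : ∀ {n k} (v : BVec n) (wt≡k : wt v ≡ k) r → onesBefore v (toℕ (pivotCol v wt≡k r)) ≡ toℕ r
pivotCol-rank v wt≡k = proj₂ ∘ proj₂ ∘ rowPivot v wt≡k

select : ∀ {n} (S : Fin n → Bool) → Fin (count S) → Fin n
select {suc n} S t with S fzero
select {suc n} S fzero    | true  = fzero
select {suc n} S (fsuc t) | true  = fsuc (select (S ∘ fsuc) t)
select {suc n} S t        | false = fsuc (select (S ∘ fsuc) t)

select-surjective : ∀ {n} (S : Fin n → Bool) j → S j ≡ true → ∃ λ t → select S t ≡ j
select-surjective {suc n} S j Sj with S fzero in S₀
select-surjective {suc n} S fzero    Sj | true  = fzero , refl
select-surjective {suc n} S (fsuc j) Sj | true  with select-surjective (S ∘ fsuc) j Sj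
... | t , refl = fsuc t , refl
select-surjective {suc n} S fzero    Sj | false with () ← trans (sym S₀) Sj
select-surjective {suc n} S (fsuc j) Sj | false with select-surjective (S ∘ fsuc) j Sj
... | t , refl = t , refl

flatten : ∀ {a} (size : Fin a → ℕ) → Σ (Fin a) (Fin ∘ size) → Fin (sumFin size)
flatten {suc a} size (fzero  , l) = l ↑ˡ sumFin (size ∘ fsuc)
flatten {suc a} size (fsuc i , l) = size fzero ↑ʳ flatten (size ∘ fsuc) (i , l)

unflatten : ∀ {a} (size : Fin a → ℕ) → Fin (sumFin size) → Σ (Fin a) (Fin ∘ size)
unflatten {suc a} size x with splitAt (size fzero) x
... | inj₁ l = fzero , l
... | inj₂ y with unflatten (size ∘ fsuc) y
...   | i , l = fsuc i , l

flatten-unflatten : ∀ {a} (size : Fin a → ℕ) x → flatten size (unflatten size x) ≡ x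
flatten-unflatten {suc a} size x with splitAt (size fzero) x in split
... | inj₁ l = Fin.splitAt⁻¹-↑ˡ split
... | inj₂ y with unflatten (size ∘ fsuc) y in eq
...   | i , l = trans (cong (size fzero ↑ʳ_) (trans (cong (flatten (size ∘ fsuc)) (sym eq))
                                                     (flatten-unflatten (size ∘ fsuc) y)))
                      (Fin.splitAt⁻¹-↑ʳ split)

unflatten-injective : ∀ {a} (size : Fin a → ℕ) {x y} → unflatten size x ≡ unflatten size y → x ≡ y
unflatten-injective size {x} {y} eq =
  trans (sym (flatten-unflatten size x)) (trans (cong (flatten size) eq) (flatten-unflatten size y))

↑-cases : ∀ {c ρ} {P : Fin (c + ρ) → Set} → (∀ i → P (i ↑ˡ ρ)) → (∀ t → P (c ↑ʳ t)) → ∀ i → P i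
↑-cases {c} {ρ} {P} left right i with splitAt c i in split
... | inj₁ l = subst P (Fin.splitAt⁻¹-↑ˡ split) (left l)
... | inj₂ t = subst P (Fin.splitAt⁻¹-↑ʳ split) (right t)

module _ {q : ℕ} (F : FiniteField q) where

  open FiniteField F
  open LinAlg F

  private
    commutativeRing : CommutativeRing _ _
    commutativeRing = record { isCommutativeRing = isCommutativeRing }

  open CommutativeRing commutativeRing
    using (+-assoc; +-comm; *-assoc; *-comm; distribˡ; distribʳ; +-identityˡ; +-identityʳ;
           *-identityˡ; *-identityʳ; zeroˡ; zeroʳ; -‿inverseˡ; -‿inverseʳ; +-abelianGroup; semiring)
  open Algebra.Properties.Semiring.Sum semiring
    using (sum; sum-cong-≗; sum-replicate-zero; sum-remove)
  open Algebra.Properties.Ring (CommutativeRing.ring commutativeRing)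
    using (-‿distribˡ-*; -‿distribʳ-*; -1*x≈-x)
  open Algebra.Properties.AbelianGroup +-abelianGroup
    using (inverseˡ-unique; ⁻¹-∙-comm; x∙y⁻¹≈ε⇒x≈y) renaming (∙-cancelˡ to +-cancelˡ)
  open Algebra.Properties.CommutativeSemigroup (CommutativeRing.+-commutativeSemigroup commutativeRing)
    using () renaming (interchange to +-interchangeᶠ; x∙yz≈y∙xz to +-leftCommᶠ)

  ∑-zero : ∀ {m} (f : Fin m → Carrier) → (∀ i → f i ≡ 0#) → sum f ≡ 0#
  ∑-zero {m} f f≡0 = trans (sum-cong-≗ f≡0) (sum-replicate-zero m)

  ∑-single : ∀ {m} (f : Fin (suc m) → Carrier) r → (∀ i → i ≢ r → f i ≡ 0#) → sum f ≡ f r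
  ∑-single f r off = begin
    sum f                              ≡⟨ sum-remove {i = r} f ⟩
    f r +ᶠ sum (f ∘ punchIn r)         ≡⟨ cong (f r +ᶠ_) (∑-zero _ (λ i → off _ (Fin.punchInᵢ≢i r i))) ⟩
    f r +ᶠ 0#                          ≡⟨ +-identityʳ _ ⟩
    f r                                ∎
    where open ≡-Reasoning

  lincomb-sum : ∀ {m n} (c : Fin m → Carrier) (B : Fin m → Vec n) j →
    lincomb c B j ≡ sum (λ i → c i *ᶠ B i j)
  lincomb-sum {zero}  c B j = refl
  lincomb-sum {suc m} c B j = cong (c fzero *ᶠ B fzero j +ᶠ_) (lincomb-sum (c ∘ fsuc) (B ∘ fsuc) j)

  lincomb-cong : ∀ {m n n′} {c c′ : Fin m → Carrier} {B : Fin m → Vec n} {C : Fin m → Vec n′} {j j′} →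
    (∀ i → c i ≡ c′ i) → (∀ i → B i j ≡ C i j′) → lincomb c B j ≡ lincomb c′ C j′
  lincomb-cong {zero}  c≡c′ Bj≡Cj′ = refl
  lincomb-cong {suc m} c≡c′ Bj≡Cj′ =
    cong₂ _+ᶠ_ (cong₂ _*ᶠ_ (c≡c′ fzero) (Bj≡Cj′ fzero)) (lincomb-cong (c≡c′ ∘ fsuc) (Bj≡Cj′ ∘ fsuc))

  lincomb-∘ : ∀ {m n n′} (c : Fin m → Carrier) (B : Fin m → Vec n) (f : Fin n′ → Fin n) j →
    lincomb c B (f j) ≡ lincomb c (λ i → B i ∘ f) j
  lincomb-∘ {zero}  c B f j = refl
  lincomb-∘ {suc m} c B f j = cong (c fzero *ᶠ B fzero (f j) +ᶠ_) (lincomb-∘ (c ∘ fsuc) (B ∘ fsuc) f j)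

  lincomb-zeroCol : ∀ {m n} (c : Fin m → Carrier) (B : Fin m → Vec n) j →
    (∀ i → B i j ≡ 0#) → lincomb c B j ≡ 0#
  lincomb-zeroCol c B j Bj≡0 =
    trans (lincomb-sum c B j) (∑-zero _ (λ i → trans (cong (c i *ᶠ_) (Bj≡0 i)) (zeroʳ (c i))))

  lincomb-zeroCoef : ∀ {m n} (B : Fin m → Vec n) → lincomb (const 0#) B ≈ zeroV
  lincomb-zeroCoef B j = trans (lincomb-sum _ B j) (∑-zero _ (λ i → zeroˡ (B i j)))

  lincomb-+M : ∀ {m n} (c : Fin m → Carrier) (A B : Matrix m n) j →
    lincomb c (A +M B) j ≡ lincomb c A j +ᶠ lincomb c B j
  lincomb-+M {zero}  c A B j = sym (+-identityˡ 0#)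
  lincomb-+M {suc m} c A B j =
    trans (cong₂ _+ᶠ_ (distribˡ (c fzero) _ _) (lincomb-+M (c ∘ fsuc) (A ∘ fsuc) (B ∘ fsuc) j))
          (+-interchangeᶠ _ _ _ _)

  lincomb-scale : ∀ {m n} x (c : Fin m → Carrier) (B : Fin m → Vec n) j →
    lincomb (λ i → x *ᶠ c i) B j ≡ x *ᶠ lincomb c B j
  lincomb-scale {zero}  x c B j = sym (zeroʳ x)
  lincomb-scale {suc m} x c B j =
    trans (cong₂ _+ᶠ_ (*-assoc x (c fzero) (B fzero j)) (lincomb-scale x (c ∘ fsuc) (B ∘ fsuc) j))
          (sym (distribˡ x _ _))

  lincomb-negM : ∀ {m n} (c : Fin m → Carrier) (B : Matrix m n) j →
    lincomb c (λ i j → -ᶠ B i j) j ≡ -ᶠ lincomb c B j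
  lincomb-negM {zero}  c B j = inverseˡ-unique 0# 0# (+-identityˡ 0#)
  lincomb-negM {suc m} c B j =
    trans (cong₂ _+ᶠ_ (sym (-‿distribʳ-* _ _)) (lincomb-negM (c ∘ fsuc) (B ∘ fsuc) j))
          (⁻¹-∙-comm _ _)

  lincomb-+coef : ∀ {m n} (c d : Fin m → Carrier) (B : Fin m → Vec n) j →
    lincomb (λ i → c i +ᶠ d i) B j ≡ lincomb c B j +ᶠ lincomb d B j
  lincomb-+coef {zero}  c d B j = sym (+-identityˡ 0#)
  lincomb-+coef {suc m} c d B j =
    trans (cong₂ _+ᶠ_ (distribʳ (B fzero j) (c fzero) (d fzero))
                      (lincomb-+coef (c ∘ fsuc) (d ∘ fsuc) (B ∘ fsuc) j))
          (+-interchangeᶠ _ _ _ _)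

  lincomb-assoc : ∀ {m p n} (c : Fin m → Carrier) (a : Fin m → Vec p) (B : Fin p → Vec n) j →
    lincomb c (λ i → lincomb (a i) B) j ≡ lincomb (lincomb c a) B j
  lincomb-assoc {zero}  c a B j = sym (lincomb-zeroCoef B j)
  lincomb-assoc {suc m} c a B j = begin
    c fzero *ᶠ lincomb (a fzero) B j +ᶠ lincomb (c ∘ fsuc) (λ i → lincomb (a (fsuc i)) B) j
      ≡⟨ cong₂ _+ᶠ_ (sym (lincomb-scale (c fzero) (a fzero) B j)) (lincomb-assoc (c ∘ fsuc) (a ∘ fsuc) B j) ⟩
    lincomb (λ t → c fzero *ᶠ a fzero t) B j +ᶠ lincomb (lincomb (c ∘ fsuc) (a ∘ fsuc)) B j
      ≡⟨ lincomb-+coef _ _ B j ⟨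
    lincomb (lincomb c a) B j ∎
    where open ≡-Reasoning

  _·_ : ∀ {m} → (Fin m → Carrier) → (Fin m → Carrier) → Carrier
  α · b = sum (λ j → α j *ᶠ b j)

  ·-*ʳ : ∀ {m} (α b : Fin m → Carrier) y → (α · (λ j → b j *ᶠ y)) ≡ (α · b) *ᶠ y
  ·-*ʳ {zero}  α b y = sym (zeroˡ y)
  ·-*ʳ {suc m} α b y =
    trans (cong₂ _+ᶠ_ (sym (*-assoc (α fzero) (b fzero) y)) (·-*ʳ (α ∘ fsuc) (b ∘ fsuc) y))
          (sym (distribʳ y _ _))

  lincomb-outer : ∀ {m n} (α b : Fin m → Carrier) (w : Vec n) t →
    lincomb α (λ j t → b j *ᶠ w t) t ≡ (α · b) *ᶠ w t
  lincomb-outer α b w t = trans (lincomb-sum α _ t) (·-*ʳ α b (w t))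

  I : ∀ {k} → Matrix k k
  I r r′ = if toℕ r ≡ᵇ toℕ r′ then 1# else 0#

  I-diag : ∀ {k} (r : Fin k) → I r r ≡ 1#
  I-diag r rewrite ≡ᵇ-refl (toℕ r) = refl

  I-off : ∀ {k} {r r′ : Fin k} → r ≢ r′ → I r r′ ≡ 0#
  I-off {r = r} {r′} r≢r′ rewrite ≢⇒≡ᵇ≡false (toℕ r) (toℕ r′) (r≢r′ ∘ Fin.toℕ-injective) = refl

  I-sym : ∀ {k} (r r′ : Fin k) → I r r′ ≡ I r′ r
  I-sym r r′ = cong (if_then 1# else 0#) (≡ᵇ-comm (toℕ r) (toℕ r′))

  lincomb-I : ∀ {k} (a : Fin k → Carrier) r → lincomb a I r ≡ a r
  lincomb-I {suc k} a r = begin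
    lincomb a I r               ≡⟨ lincomb-sum a I r ⟩
    sum (λ r′ → a r′ *ᶠ I r′ r)  ≡⟨ ∑-single _ r (λ r′ r′≢r → trans (cong (a r′ *ᶠ_) (I-off r′≢r)) (zeroʳ _)) ⟩
    a r *ᶠ I r r                ≡⟨ trans (cong (a r *ᶠ_) (I-diag r)) (*-identityʳ _) ⟩
    a r                         ∎
    where open ≡-Reasoning

  lincomb-I-row : ∀ {m n} (B : Fin m → Vec n) i → lincomb (I i) B ≈ B i
  lincomb-I-row {suc m} B i j = begin
    lincomb (I i) B j            ≡⟨ lincomb-sum (I i) B j ⟩
    sum (λ r → I i r *ᶠ B r j)    ≡⟨ ∑-single _ i (λ r r≢i →
                                     trans (cong (_*ᶠ B r j) (I-off (r≢i ∘ sym))) (zeroˡ _)) ⟩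
    I i i *ᶠ B i j               ≡⟨ trans (cong (_*ᶠ B i j) (I-diag i)) (*-identityˡ _) ⟩
    B i j                        ∎
    where open ≡-Reasoning

  InSpan-row : ∀ {m n} (B : Fin m → Vec n) i → InSpan B (B i)
  InSpan-row B i = I i , lincomb-I-row B i

  _≟ᶠ_ : (x y : Carrier) → Dec (x ≡ y)
  _≟ᶠ_ = Fin.inj⇒≟ (↔⇒↣ enumeration)

  lincomb-insertAt : ∀ {m n} (α : Fin m → Carrier) i x (B : Fin (suc m) → Vec n) t →
    lincomb (insertAt α i x) B t ≡ x *ᶠ B i t +ᶠ lincomb α (B ∘ punchIn i) t
  lincomb-insertAt         α fzero    x B t = refl
  lincomb-insertAt {suc m} α (fsuc i) x B t =
    trans (cong (α fzero *ᶠ B fzero t +ᶠ_) (lincomb-insertAt (α ∘ fsuc) i x (B ∘ fsuc) t))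
          (+-leftCommᶠ _ _ _)

  LinIndep-dropHead : ∀ {m n} (B : Fin m → Vec (suc n)) → (∀ i → B i fzero ≡ 0#) →
    LinIndep B → LinIndep (λ i → B i ∘ fsuc)
  LinIndep-dropHead B B₀≡0 indep α αB≡0 = indep α vanish
    where
    vanish : lincomb α B ≈ zeroV
    vanish fzero    = lincomb-zeroCol α B fzero B₀≡0
    vanish (fsuc t) = trans (lincomb-∘ α B fsuc t) (αB≡0 t)

  -- One step of Gaussian elimination, pivoting on the nonzero entry B i 0: every combination of the
  -- eliminated rows is the tail of a combination of the rows of B whose head vanishes.
  module Elimination {m n} (B : Fin (suc m) → Vec (suc n)) (i : Fin (suc m)) (p≢0 : B i fzero ≢ 0#) where
    p p⁻¹ : Carrier
    p = B i fzero
    p⁻¹ = proj₁ (inverse p p≢0)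

    w : Vec n
    w = B i ∘ fsuc

    b μ : Fin m → Carrier
    b j = B (punchIn i j) fzero
    μ j = b j *ᶠ p⁻¹

    eliminated : Fin m → Vec n
    eliminated j t = B (punchIn i j) (fsuc t) +ᶠ -ᶠ (μ j *ᶠ w t)

    lift : (Fin m → Carrier) → Fin (suc m) → Carrier
    lift α = insertAt α i (-ᶠ (α · μ))

    lift-head : ∀ α → lincomb (lift α) B fzero ≡ 0#
    lift-head α = begin
      lincomb (lift α) B fzero           ≡⟨ lincomb-insertAt α i _ B fzero ⟩
      -ᶠ (α · μ) *ᶠ p +ᶠ S₀               ≡⟨ cong (_+ᶠ S₀) (trans (sym (-‿distribˡ-* _ p)) (cong -ᶠ_ α·μ*p≡S₀)) ⟩
      -ᶠ S₀ +ᶠ S₀                        ≡⟨ -‿inverseˡ S₀ ⟩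
      0#                                 ∎
      where
      open ≡-Reasoning
      S₀ : Carrier
      S₀ = lincomb α (B ∘ punchIn i) fzero
      α·μ*p≡S₀ : (α · μ) *ᶠ p ≡ S₀
      α·μ*p≡S₀ = begin
        (α · μ) *ᶠ p              ≡⟨ cong (_*ᶠ p) (·-*ʳ α b p⁻¹) ⟩
        ((α · b) *ᶠ p⁻¹) *ᶠ p      ≡⟨ *-assoc _ p⁻¹ p ⟩
        (α · b) *ᶠ (p⁻¹ *ᶠ p)      ≡⟨ cong ((α · b) *ᶠ_) (trans (*-comm p⁻¹ p) (proj₂ (inverse p p≢0))) ⟩
        (α · b) *ᶠ 1#             ≡⟨ *-identityʳ _ ⟩
        α · b                     ≡⟨ lincomb-sum α (B ∘ punchIn i) fzero ⟨
        S₀                        ∎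

    lift-tail : ∀ α t → lincomb (lift α) B (fsuc t) ≡ lincomb α eliminated t
    lift-tail α t = begin
      lincomb (lift α) B (fsuc t)                     ≡⟨ lincomb-insertAt α i _ B (fsuc t) ⟩
      -ᶠ (α · μ) *ᶠ w t +ᶠ L                          ≡⟨ +-comm _ L ⟩
      L +ᶠ -ᶠ (α · μ) *ᶠ w t                          ≡⟨ cong (L +ᶠ_) (sym (-‿distribˡ-* _ (w t))) ⟩
      L +ᶠ -ᶠ ((α · μ) *ᶠ w t)                        ≡⟨ cong (λ y → L +ᶠ -ᶠ y) (lincomb-outer α μ w t) ⟨
      L +ᶠ -ᶠ lincomb α (λ j t → μ j *ᶠ w t) t        ≡⟨ cong₂ _+ᶠ_ (sym (lincomb-∘ α (B ∘ punchIn i) fsuc t))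
                                                                    (lincomb-negM α _ t) ⟨
      lincomb α (λ j t → B (punchIn i j) (fsuc t)) t +ᶠ lincomb α (λ j t → -ᶠ (μ j *ᶠ w t)) t
                                                      ≡⟨ lincomb-+M α _ _ t ⟨
      lincomb α eliminated t                          ∎
      where
      open ≡-Reasoning
      L : Carrier
      L = lincomb α (B ∘ punchIn i) (fsuc t)

  LinIndep-eliminate : ∀ {m n} (B : Fin (suc m) → Vec (suc n)) i → B i fzero ≢ 0# →
    LinIndep B → Σ (Fin m → Vec n) LinIndep
  LinIndep-eliminate B i p≢0 indep = eliminated , λ α αC≡0 j →
    trans (sym (Vector.insertAt-punchIn α i _ j)) (indep (lift α) (vanish α αC≡0) (punchIn i j))
    where
    open Elimination B i p≢0
    vanish : ∀ α → lincomb α eliminated ≈ zeroV → lincomb (lift α) B ≈ zeroV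
    vanish α αC≡0 fzero    = lift-head α
    vanish α αC≡0 (fsuc t) = trans (lift-tail α t) (αC≡0 t)

  LinIndep⇒≤ : ∀ {m n} (B : Fin m → Vec n) → LinIndep B → m ≤ n
  LinIndep⇒≤ {zero}          B indep = z≤n
  LinIndep⇒≤ {suc m} {zero}  B indep = ⊥-elim (0≢1 (sym (indep (const 1#) (λ ()) fzero)))
  LinIndep⇒≤ {suc m} {suc n} B indep with Fin.any? (λ i → ¬? (B i fzero ≟ᶠ 0#))
  ... | yes (i , p≢0) = s≤s (LinIndep⇒≤ _ (proj₂ (LinIndep-eliminate B i p≢0 indep)))
  ... | no  noPivot   = ℕ.m≤n⇒m≤1+n (LinIndep⇒≤ (λ i → B i ∘ fsuc) (LinIndep-dropHead B column₀≡0 indep))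
    where
    column₀≡0 : ∀ i → B i fzero ≡ 0#
    column₀≡0 i = decidable-stable (B i fzero ≟ᶠ 0#) (λ p≢0 → noPivot (i , p≢0))

  private
    module Enum = Inverse enumeration

  ∃ᶠ? : (P : Carrier → Set) → (∀ x → Dec (P x)) → Dec (Σ Carrier P)
  ∃ᶠ? P P? with Fin.any? (P? ∘ Enum.from)
  ... | yes (k , p) = yes (Enum.from k , p)
  ... | no  ¬∃      = no λ (x , px) → ¬∃ (Enum.to x , subst P (sym (Enum.strictlyInverseʳ x)) px)

  ∃-Vec? : ∀ m (P : Vec m → Set) → (∀ v → Dec (P v)) → (∀ {v w} → v ≈ w → P v → P w) →
    Dec (Σ (Vec m) P)
  ∃-Vec? zero P P? P-resp with P? (λ ())
  ... | yes p = yes ((λ ()) , p)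
  ... | no ¬p = no λ (v , pv) → ¬p (P-resp (λ ()) pv)
  ∃-Vec? (suc m) P P? P-resp with ∃ᶠ? (λ x → Σ (Vec m) (P ∘ (x ∷_))) (λ x → ∃-Vec? m (P ∘ (x ∷_)) (P? ∘ (x ∷_))
                                       (λ v≈w → P-resp λ { fzero → refl ; (fsuc j) → v≈w j }))
  ... | yes (x , v , p) = yes (x ∷ v , p)
  ... | no  ¬∃          =
    no λ (v , pv) → ¬∃ (head v , tail v , P-resp (λ { fzero → refl ; (fsuc j) → refl }) pv)

  InSpan? : ∀ {m n} (B : Fin m → Vec n) v → Dec (InSpan B v)
  InSpan? {m} B v = ∃-Vec? m (λ c → lincomb c B ≈ v) (λ c → Fin.all? (λ j → lincomb c B j ≟ᶠ v j))
    (λ c≈c′ cB≈v j → trans (lincomb-cong (sym ∘ c≈c′) (λ _ → refl)) (cB≈v j))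

  InSpan-resp : ∀ {m n} (B : Fin m → Vec n) {v w} → v ≈ w → InSpan B v → InSpan B w
  InSpan-resp B v≈w (c , cB≈v) = c , λ j → trans (cB≈v j) (v≈w j)

  InSpan-lincomb : ∀ {m p n} (B : Fin p → Vec n) (L : Fin m → Vec n) → (∀ i → InSpan B (L i)) →
    ∀ α → InSpan B (lincomb α L)
  InSpan-lincomb B L L∈B α = lincomb α (proj₁ ∘ L∈B) , λ j →
    trans (sym (lincomb-assoc α (proj₁ ∘ L∈B) B j)) (lincomb-cong (λ _ → refl) (λ i → proj₂ (L∈B i) j))

  LinIndep-∷ : ∀ {m n} (w : Vec n) (L : Fin m → Vec n) → LinIndep L → ¬ InSpan L w → LinIndep (w ∷ L)
  LinIndep-∷ w L indep w∉L α αwL≡0 with α fzero ≟ᶠ 0#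
  ... | yes α₀≡0 = λ { fzero → α₀≡0 ; (fsuc i) → indep (α ∘ fsuc) αL≡0 i }
    where
    αL≡0 : lincomb (α ∘ fsuc) L ≈ zeroV
    αL≡0 t = begin
      y                      ≡⟨ +-identityˡ y ⟨
      0# +ᶠ y                ≡⟨ cong (_+ᶠ y) (trans (cong (_*ᶠ w t) α₀≡0) (zeroˡ (w t))) ⟨
      α fzero *ᶠ w t +ᶠ y    ≡⟨ αwL≡0 t ⟩
      0#                     ∎
      where
      open ≡-Reasoning
      y : Carrier
      y = lincomb (α ∘ fsuc) L t
  ... | no α₀≢0 = ⊥-elim (w∉L ((λ i → (-ᶠ a) *ᶠ α (fsuc i)) , λ t → sym (w≡ t)))
    where
    a : Carrier
    a = proj₁ (inverse (α fzero) α₀≢0)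
    aα₀≡1 : a *ᶠ α fzero ≡ 1#
    aα₀≡1 = trans (*-comm _ _) (proj₂ (inverse (α fzero) α₀≢0))
    w≡ : ∀ t → w t ≡ lincomb (λ i → (-ᶠ a) *ᶠ α (fsuc i)) L t
    w≡ t = begin
      w t                              ≡⟨ *-identityˡ _ ⟨
      1# *ᶠ w t                        ≡⟨ cong (_*ᶠ w t) aα₀≡1 ⟨
      (a *ᶠ α fzero) *ᶠ w t            ≡⟨ *-assoc _ _ _ ⟩
      a *ᶠ (α fzero *ᶠ w t)            ≡⟨ cong (a *ᶠ_) (inverseˡ-unique _ _ (αwL≡0 t)) ⟩
      a *ᶠ -ᶠ y                        ≡⟨ trans (sym (-‿distribʳ-* _ _)) (-‿distribˡ-* _ _) ⟩
      (-ᶠ a) *ᶠ y                      ≡⟨ lincomb-scale _ _ L t ⟨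
      lincomb (λ i → (-ᶠ a) *ᶠ α (fsuc i)) L t ∎
      where
      open ≡-Reasoning
      y : Carrier
      y = lincomb (α ∘ fsuc) L t

  record DecSubspace {n} (W : Subset n) : Set where
    field
      decide   : ∀ v → Dec (W v)
      respects : ∀ {v w} → v ≈ w → W v → W w
      closed   : ∀ {m} (L : Fin m → Vec n) → (∀ i → W (L i)) → ∀ α → W (lincomb α L)

  DecSubspace⇒HasDim : ∀ {n} {W : Subset n} → DecSubspace W → Σ ℕ (HasDim W)
  DecSubspace⇒HasDim {n} {W} W-sub = extend (suc n) {0} (λ ()) (λ α _ ()) (λ ()) ℕ.≤-refl
    where
    open DecSubspace W-sub
    -- Greedily extend an independent family in W; fuel bounds the number of steps by Steinitz.
    extend : ∀ fuel {m} (L : Fin m → Vec n) → LinIndep L → (∀ i → W (L i)) → n < m + fuel → Σ ℕ (HasDim W)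
    extend fuel {m} L indep L∈W n<m+fuel
      with ∃-Vec? n (λ w → W w × ¬ InSpan L w) (λ w → decide w ×-dec ¬? (InSpan? L w))
                  (λ v≈w (v∈W , v∉L) → respects v≈w v∈W , v∉L ∘ InSpan-resp L (sym ∘ v≈w))
    ... | no  W⊆L = m , L , indep , λ v → W⊆span v , λ (c , cL≈v) → respects cL≈v (closed L L∈W c)
      where
      W⊆span : ∀ v → W v → InSpan L v
      W⊆span v v∈W = decidable-stable (InSpan? L v) (λ v∉L → W⊆L (v , v∈W , v∉L))
    ... | yes (w , w∈W , w∉L) with fuel
    ...   | zero     = ⊥-elim (ℕ.<⇒≱ (subst (n <_) (ℕ.+-identityʳ m) n<m+fuel) (LinIndep⇒≤ L indep))
    ...   | suc fuel = extend fuel (w ∷ L) (LinIndep-∷ w L indep w∉L) (λ { fzero → w∈W ; (fsuc i) → L∈W i })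
                         (subst (n <_) (ℕ.+-suc m fuel) n<m+fuel)

  RowSpace-∩-decSubspace : ∀ {a b n} (A : Fin a → Vec n) (B : Fin b → Vec n) →
    DecSubspace (RowSpace A ∩ RowSpace B)
  RowSpace-∩-decSubspace A B = record
    { decide   = λ v → InSpan? A v ×-dec InSpan? B v
    ; respects = λ v≈w (v∈A , v∈B) → InSpan-resp A v≈w v∈A , InSpan-resp B v≈w v∈B
    ; closed   = λ L L∈A∩B α → InSpan-lincomb A L (proj₁ ∘ L∈A∩B) α , InSpan-lincomb B L (proj₂ ∘ L∈A∩B) α
    }

  ++-fsuc : ∀ {c ρ} {A : Set} (a : Fin (suc c) → A) (e : Fin ρ → A) i →
    (a ++ e) (fsuc i) ≡ ((a ∘ fsuc) ++ e) i
  ++-fsuc {c} a e i with splitAt c i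
  ... | inj₁ l = refl
  ... | inj₂ t = refl

  lincomb-++ : ∀ {c ρ n} (γ : Fin (c + ρ) → Carrier) (a : Fin c → Vec n) (e : Fin ρ → Vec n) j →
    lincomb γ (a ++ e) j ≡ lincomb (γ ∘ (_↑ˡ ρ)) a j +ᶠ lincomb (γ ∘ (c ↑ʳ_)) e j
  lincomb-++ {zero}  γ a e j = sym (+-identityˡ _)
  lincomb-++ {suc c} γ a e j = begin
    γ fzero *ᶠ a fzero j +ᶠ lincomb (γ ∘ fsuc) ((a ++ e) ∘ fsuc) j
      ≡⟨ cong (γ fzero *ᶠ a fzero j +ᶠ_) (lincomb-cong (λ _ → refl) (λ i → cong (_$ j) (++-fsuc a e i))) ⟩
    γ fzero *ᶠ a fzero j +ᶠ lincomb (γ ∘ fsuc) ((a ∘ fsuc) ++ e) j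
      ≡⟨ cong (γ fzero *ᶠ a fzero j +ᶠ_) (lincomb-++ (γ ∘ fsuc) (a ∘ fsuc) e j) ⟩
    γ fzero *ᶠ a fzero j +ᶠ (lincomb (γ ∘ fsuc ∘ (_↑ˡ _)) (a ∘ fsuc) j +ᶠ lincomb (γ ∘ (suc c ↑ʳ_)) e j)
      ≡⟨ +-assoc _ _ _ ⟨
    lincomb (γ ∘ (_↑ˡ _)) a j +ᶠ lincomb (γ ∘ (suc c ↑ʳ_)) e j ∎
    where open ≡-Reasoning

  LinIndep-++ : ∀ {c ρ n} (a : Fin c → Vec n) (e : Fin ρ → Vec n) → LinIndep a → LinIndep e →
    (∀ α β → (∀ j → lincomb α a j +ᶠ lincomb β e j ≡ 0#) → lincomb β e ≈ zeroV) → LinIndep (a ++ e)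
  LinIndep-++ {c} {ρ} a e indep-a indep-e disjoint γ γae≡0 = ↑-cases γ-left≡0 γ-right≡0
    where
    split≡0 : ∀ j → lincomb (γ ∘ (_↑ˡ ρ)) a j +ᶠ lincomb (γ ∘ (c ↑ʳ_)) e j ≡ 0#
    split≡0 j = trans (sym (lincomb-++ γ a e j)) (γae≡0 j)
    γ-right≡0 : ∀ t → γ (c ↑ʳ t) ≡ 0#
    γ-right≡0 = indep-e _ (disjoint _ _ split≡0)
    γ-left≡0 : ∀ i → γ (i ↑ˡ ρ) ≡ 0#
    γ-left≡0 = indep-a _ λ j →
      trans (sym (trans (cong (_ +ᶠ_) (disjoint _ _ split≡0 j)) (+-identityʳ _))) (split≡0 j)

  lincomb-coefficients : ∀ {c k n} (a : Fin c → Vec k) (X : Matrix k n) (u : Fin c → Vec n) →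
    (∀ i → lincomb (a i) X ≈ u i) → ∀ α j → lincomb α u j ≡ lincomb (lincomb α a) X j
  lincomb-coefficients a X u aX≈u α j =
    trans (lincomb-cong (λ _ → refl) (λ i → sym (aX≈u i j))) (lincomb-assoc α a X j)

  lincomb-zeroCoefficients : ∀ {c k n} (a : Fin c → Vec k) (X : Matrix k n) (u : Fin c → Vec n) →
    (∀ i → lincomb (a i) X ≈ u i) → ∀ α → (∀ r → lincomb α a r ≡ 0#) → lincomb α u ≈ zeroV
  lincomb-zeroCoefficients a X u aX≈u α αa≡0 j =
    trans (lincomb-coefficients a X u aX≈u α j) (trans (lincomb-cong αa≡0 (λ _ → refl)) (lincomb-zeroCoef X j))

  LinIndep-coefficients : ∀ {c k n} (a : Fin c → Vec k) (X : Matrix k n) (u : Fin c → Vec n) →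
    (∀ i → lincomb (a i) X ≈ u i) → LinIndep u → LinIndep a
  LinIndep-coefficients a X u aX≈u indep-u α αa≡0 = indep-u α (lincomb-zeroCoefficients a X u aX≈u α αa≡0)

  -- Extend the kernel vectors a by coefficient vectors of a basis of the row space of M.
  kernel+rank≤rows : ∀ {c k m δ} (a : Fin c → Vec k) (M : Matrix k m) → LinIndep a →
    (∀ i → lincomb (a i) M ≈ zeroV) → RankAtLeast M δ → c + δ ≤ k
  kernel+rank≤rows {c} {k} a M indep-a aM≡0 (ρ , (B , indep-B , B≡rows) , δ≤ρ) =
    ℕ.≤-trans (ℕ.+-monoʳ-≤ c δ≤ρ) (LinIndep⇒≤ (a ++ e) (LinIndep-++ a e indep-a indep-e disjoint))
    where
    B∈rows : ∀ t → InSpan M (B t)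
    B∈rows t = proj₂ (B≡rows (B t)) (InSpan-row B t)
    e : Fin ρ → Vec k
    e = proj₁ ∘ B∈rows
    indep-e : LinIndep e
    indep-e = LinIndep-coefficients e M B (proj₂ ∘ B∈rows) indep-B
    disjoint : ∀ α β → (∀ j → lincomb α a j +ᶠ lincomb β e j ≡ 0#) → lincomb β e ≈ zeroV
    disjoint α β αa+βe≡0 t = trans (lincomb-cong β≡0 (λ _ → refl)) (lincomb-zeroCoef e t)
      where
      αaM≡0 : ∀ j → lincomb (lincomb α a) M j ≡ 0#
      αaM≡0 j = trans (sym (lincomb-assoc α a M j)) (lincomb-zeroCol α _ j (λ i → aM≡0 i j))
      βB≡0 : lincomb β B ≈ zeroV
      βB≡0 j = begin
        lincomb β B j                                           ≡⟨ lincomb-coefficients e M B (proj₂ ∘ B∈rows) β j ⟩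
        lincomb (lincomb β e) M j                               ≡⟨ +-identityˡ _ ⟨
        0# +ᶠ lincomb (lincomb β e) M j                         ≡⟨ cong (_+ᶠ _) (αaM≡0 j) ⟨
        lincomb (lincomb α a) M j +ᶠ lincomb (lincomb β e) M j  ≡⟨ lincomb-+coef _ _ M j ⟨
        lincomb (λ t → lincomb α a t +ᶠ lincomb β e t) M j      ≡⟨ lincomb-cong αa+βe≡0 (λ _ → refl) ⟩
        lincomb (const 0#) M j                                  ≡⟨ lincomb-zeroCoef M j ⟩
        0#                                                      ∎
        where open ≡-Reasoning
      β≡0 : ∀ t → β t ≡ 0#
      β≡0 = indep-B β βB≡0

  MeetCodim≥ : ∀ {k n} → Matrix k n → Matrix k n → ℕ → Set
  MeetCodim≥ {k} {n} X Y δ = ∀ {c} (u : Fin c → Vec n) → LinIndep u →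
    (∀ i → InSpan X (u i)) → (∀ i → InSpan Y (u i)) → c + δ ≤ k

  MeetCodim≥-sym : ∀ {k n} {X Y : Matrix k n} {δ} → MeetCodim≥ X Y δ → MeetCodim≥ Y X δ
  MeetCodim≥-sym XY u indep u∈Y u∈X = XY u indep u∈X u∈Y

  LinIndep⇒HasRank : ∀ {k n} (X : Matrix k n) → LinIndep X → HasDim (RowSpace X) k
  LinIndep⇒HasRank X indep = X , indep , λ v → (λ v∈X → v∈X) , (λ v∈X → v∈X)

  MeetCodim≥⇒dS≥ : ∀ {k n} {X Y : Matrix k n} {δ} → LinIndep X → LinIndep Y → MeetCodim≥ X Y δ →
    dS≥ (RowSpace X) (RowSpace Y) (2 * δ)
  MeetCodim≥⇒dS≥ {k} {X = X} {Y} {δ} indep-X indep-Y codim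
    with DecSubspace⇒HasDim (RowSpace-∩-decSubspace X Y)
  ... | c , meet@(u , indep-u , u≡meet) =
    k , k , c , LinIndep⇒HasRank X indep-X , LinIndep⇒HasRank Y indep-Y , meet ,
    subst (_≤ k + k) (double-sum c δ) (ℕ.+-mono-≤ c+δ≤k c+δ≤k)
    where
    u∈meet : ∀ i → (RowSpace X ∩ RowSpace Y) (u i)
    u∈meet i = proj₂ (u≡meet (u i)) (InSpan-row u i)
    c+δ≤k : c + δ ≤ k
    c+δ≤k = codim u indep-u (proj₁ ∘ u∈meet) (proj₂ ∘ u∈meet)
    double-sum : ∀ x y → (x + y) + (x + y) ≡ 2 * y + 2 * x
    double-sum = solve-∀

  lincomb-−M≡0 : ∀ {m n} (a : Fin m → Carrier) (A B : Matrix m n) →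
    lincomb a A ≈ lincomb a B → lincomb a (A -M B) ≈ zeroV
  lincomb-−M≡0 a A B aA≈aB j = begin
    lincomb a (A -M B) j                                ≡⟨ lincomb-+M a A _ j ⟩
    lincomb a A j +ᶠ lincomb a (λ i j → -ᶠ B i j) j      ≡⟨ cong₂ _+ᶠ_ (aA≈aB j) (lincomb-negM a B j) ⟩
    lincomb a B j +ᶠ -ᶠ lincomb a B j                   ≡⟨ -‿inverseʳ _ ⟩
    0#                                                  ∎
    where open ≡-Reasoning

  Pivots : ∀ {k n} → Matrix k n → (Fin k → Fin n) → Set
  Pivots X piv = ∀ r r′ → X r′ (piv r) ≡ I r′ r

  Pivots-readout : ∀ {k n} {X : Matrix k n} {piv} → Pivots X piv → ∀ a r → lincomb a X (piv r) ≡ a r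
  Pivots-readout pivots a r = trans (lincomb-cong (λ _ → refl) (pivots r)) (lincomb-I a r)

  Pivots-vanishing : ∀ {c k n} {X : Matrix k n} {piv} {a : Fin c → Vec k} {u : Fin c → Vec n} →
    Pivots X piv → (∀ i → lincomb (a i) X ≈ u i) →
    ∀ α → (∀ r → lincomb α u (piv r) ≡ 0#) → lincomb α u ≈ zeroV
  Pivots-vanishing {X = X} {piv} {a} {u} pivots aX≈u α αu≡0 = lincomb-zeroCoefficients a X u aX≈u α λ r →
    trans (sym (Pivots-readout pivots (lincomb α a) r))
          (trans (sym (lincomb-coefficients a X u aX≈u α (piv r))) (αu≡0 r))

  Pivots⇒LinIndep : ∀ {k n} {X : Matrix k n} {piv} → Pivots X piv → LinIndep X
  Pivots⇒LinIndep pivots a aX≡0 r = trans (sym (Pivots-readout pivots a r)) (aX≡0 _)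

  MeetCodim≥-samePivots : ∀ {k n m δ} {X Y : Matrix k n} {piv} → Pivots X piv → Pivots Y piv →
    (M : Matrix k m) → RankAtLeast M δ → (∀ a → lincomb a X ≈ lincomb a Y → lincomb a M ≈ zeroV) →
    MeetCodim≥ X Y δ
  MeetCodim≥-samePivots {k} {X = X} {Y} {piv} pivots-X pivots-Y M rank-M kernel {c} u indep-u u∈X u∈Y =
    kernel+rank≤rows a M (LinIndep-coefficients a X u (proj₂ ∘ u∈X) indep-u)
      (λ i → kernel (a i) (aX≈aY i)) rank-M
    where
    a b : Fin c → Vec k
    a = proj₁ ∘ u∈X
    b = proj₁ ∘ u∈Y
    a≡b : ∀ i r → a i r ≡ b i r
    a≡b i r = begin
      a i r                  ≡⟨ Pivots-readout pivots-X (a i) r ⟨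
      lincomb (a i) X (piv r) ≡⟨ proj₂ (u∈X i) (piv r) ⟩
      u i (piv r)            ≡⟨ proj₂ (u∈Y i) (piv r) ⟨
      lincomb (b i) Y (piv r) ≡⟨ Pivots-readout pivots-Y (b i) r ⟩
      b i r                  ∎
      where open ≡-Reasoning
    aX≈aY : ∀ i → lincomb (a i) X ≈ lincomb (a i) Y
    aX≈aY i j =
      trans (proj₂ (u∈X i) j) (trans (sym (proj₂ (u∈Y i) j)) (lincomb-cong (sym ∘ a≡b i) (λ _ → refl)))

  DotSupported : ∀ {n k} → BVec n → Matrix k n → Set
  DotSupported v W = ∀ i j → ¬ IsDot v i j → W i j ≡ 0#

  -- EF(v) with every dot 0, so that EF v +M W is EF(v) filled with W (the matrix MultilevelCDC.filled).
  EF : ∀ {n k} → BVec n → Matrix k n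
  EF v r j = if v j ∧ (onesBefore v (toℕ j) ≡ᵇ toℕ r) then 1# else 0#

  record Echelon {n k} (v : BVec n) (X : Matrix k n) : Set where
    field
      piv         : Fin k → Fin n
      piv-one     : ∀ r → v (piv r) ≡ true
      piv-rank    : ∀ r → onesBefore v (toℕ (piv r)) ≡ toℕ r
      pivots      : Pivots X piv
      nonDot-zero : ∀ r j → v j ≡ false → ¬ IsDot v r j → X r j ≡ 0#

  EF-pivots : ∀ {n k} (v : BVec n) (wt≡k : wt v ≡ k) (W : Matrix k n) → DotSupported v W →
    Pivots (EF v +M W) (pivotCol v wt≡k)
  EF-pivots {n} v wt≡k W W-dots r r′ = begin
    EF v r′ j +ᶠ W r′ j   ≡⟨ cong₂ _+ᶠ_ EF≡I (W-dots r′ j pivot-not-dot) ⟩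
    I r r′ +ᶠ 0#          ≡⟨ trans (+-identityʳ _) (I-sym r r′) ⟩
    I r′ r                ∎
    where
    open ≡-Reasoning
    j : Fin n
    j = pivotCol v wt≡k r
    EF≡I : EF v r′ j ≡ I r r′
    EF≡I = cong (if_then 1# else 0#)
      (cong₂ _∧_ (pivotCol-one v wt≡k r) (cong (_≡ᵇ toℕ r′) (pivotCol-rank v wt≡k r)))
    pivot-not-dot : ¬ IsDot v r′ j
    pivot-not-dot (v≡false , _) with () ← trans (sym (pivotCol-one v wt≡k r)) v≡false

  EF-echelon : ∀ {n k} (v : BVec n) → wt v ≡ k → (W : Matrix k n) → DotSupported v W →
    Echelon v (EF v +M W)
  EF-echelon v wt≡k W W-dots = record
    { piv         = pivotCol v wt≡k
    ; piv-one     = pivotCol-one v wt≡k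
    ; piv-rank    = pivotCol-rank v wt≡k
    ; pivots      = EF-pivots v wt≡k W W-dots
    ; nonDot-zero = nonDot-zero
    }
    where
    nonDot-zero : ∀ r j → v j ≡ false → ¬ IsDot v r j → (EF v +M W) r j ≡ 0#
    nonDot-zero r j v≡false ¬dot = trans (cong₂ _+ᶠ_ EF≡0 (W-dots r j ¬dot)) (+-identityˡ 0#)
      where
      EF≡0 : EF v r j ≡ 0#
      EF≡0 = cong (λ b → if b ∧ (onesBefore v (toℕ j) ≡ᵇ toℕ r) then 1# else 0#) v≡false

  MeetCodim≥-sameVector : ∀ {n k δ} (v : BVec n) → wt v ≡ k → (W₁ W₂ M : Matrix k n) →
    DotSupported v W₁ → DotSupported v W₂ → M ≈M (W₁ -M W₂) → RankAtLeast M δ →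
    MeetCodim≥ (EF v +M W₁) (EF v +M W₂) δ
  MeetCodim≥-sameVector v wt≡k W₁ W₂ M W₁-dots W₂-dots M≈W₁-W₂ rank-M =
    MeetCodim≥-samePivots (EF-pivots v wt≡k W₁ W₁-dots) (EF-pivots v wt≡k W₂ W₂-dots) M rank-M kernel
    where
    kernel : ∀ a → lincomb a (EF v +M W₁) ≈ lincomb a (EF v +M W₂) → lincomb a M ≈ zeroV
    kernel a aX≈aY j = trans (lincomb-cong (λ _ → refl) (λ i → M≈W₁-W₂ i j)) (lincomb-−M≡0 a W₁ W₂ aW₁≈aW₂ j)
      where
      aW₁≈aW₂ : lincomb a W₁ ≈ lincomb a W₂
      aW₁≈aW₂ t = +-cancelˡ (lincomb a (EF v) t) _ _
        (trans (sym (lincomb-+M a (EF v) W₁ t)) (trans (aX≈aY t) (lincomb-+M a (EF v) W₂ t)))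

  module _ {n k} {v w : BVec n} {X Y : Matrix k n} (EX : Echelon v X) (EY : Echelon w Y) where
    private
      module EX = Echelon EX
      module EY = Echelon EY

    -- Either w has a one in the pivot column j of row r, where x vanishes, or every row of Y with
    -- pivot at or right of j vanishes in column j, while the rows pivoting left of j have coefficient 0.
    pivotCoefficient≡0 : (A B : Fin k → Carrier) (x : Vec n) → lincomb A X ≈ x → lincomb B Y ≈ x →
      (∀ j → v j ≡ true → w j ≡ true → x j ≡ 0#) → ∀ r →
      (∀ r′ → toℕ (EY.piv r′) < toℕ (EX.piv r) → B r′ ≡ 0#) → A r ≡ 0#
    pivotCoefficient≡0 A B x AX≈x BY≈x common≡0 r left≡0 with w (EX.piv r) in w-j
    ... | true  = trans (sym (Pivots-readout EX.pivots A r)) (trans (AX≈x _) (common≡0 _ (EX.piv-one r) w-j))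
    ... | false = begin
      A r                          ≡⟨ Pivots-readout EX.pivots A r ⟨
      lincomb A X j                ≡⟨ trans (AX≈x j) (sym (BY≈x j)) ⟩
      lincomb B Y j                ≡⟨ lincomb-sum B Y j ⟩
      sum (λ r′ → B r′ *ᶠ Y r′ j)   ≡⟨ ∑-zero _ term≡0 ⟩
      0#                           ∎
      where
      open ≡-Reasoning
      j : Fin n
      j = EX.piv r
      term≡0 : ∀ r′ → B r′ *ᶠ Y r′ j ≡ 0#
      term≡0 r′ with toℕ (EY.piv r′) ℕ.<? toℕ j
      ... | yes left = trans (cong (_*ᶠ Y r′ j) (left≡0 r′ left)) (zeroˡ _)
      ... | no ¬left = trans (cong (B r′ *ᶠ_) (EY.nonDot-zero r′ j w-j not-dot)) (zeroʳ _)
        where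
        not-dot : ¬ IsDot w r′ j
        not-dot (_ , r′<ones) = ℕ.<⇒≱ r′<ones (subst (onesBefore w (toℕ j) ≤_) (EY.piv-rank r′)
                                                      (onesBefore-mono w (ℕ.≮⇒≥ ¬left)))

  module _ {n k} {v w : BVec n} {X Y : Matrix k n} (EX : Echelon v X) (EY : Echelon w Y) where
    private
      module EX = Echelon EX
      module EY = Echelon EY

    commonZero⇒coefficients≡0 : (A B : Fin k → Carrier) (x : Vec n) → lincomb A X ≈ x → lincomb B Y ≈ x →
      (∀ j → v j ≡ true → w j ≡ true → x j ≡ 0#) → ∀ r → A r ≡ 0#
    commonZero⇒coefficients≡0 A B x AX≈x BY≈x common≡0 r = proj₁ (leftOf n) r (Fin.toℕ<n (EX.piv r))
      where
      leftOf : ∀ m → (∀ r → toℕ (EX.piv r) < m → A r ≡ 0#) × (∀ r → toℕ (EY.piv r) < m → B r ≡ 0#)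
      leftOf zero    = (λ _ ()) , (λ _ ())
      leftOf (suc m) with leftOf m
      ... | A≡0 , B≡0 = A′≡0 , B′≡0
        where
        A′≡0 : ∀ r → toℕ (EX.piv r) < suc m → A r ≡ 0#
        A′≡0 r (s≤s le) with ℕ.m≤n⇒m<n∨m≡n le
        ... | inj₁ lt   = A≡0 r lt
        ... | inj₂ refl = pivotCoefficient≡0 EX EY A B x AX≈x BY≈x common≡0 r B≡0
        B′≡0 : ∀ r → toℕ (EY.piv r) < suc m → B r ≡ 0#
        B′≡0 r (s≤s le) with ℕ.m≤n⇒m<n∨m≡n le
        ... | inj₁ lt   = B≡0 r lt
        ... | inj₂ refl = pivotCoefficient≡0 EY EX B A x BY≈x AX≈x (λ j wj vj → common≡0 j vj wj) r A≡0

  MeetCodim≥-distinctVectors : ∀ {n k δ} {v w : BVec n} {X Y : Matrix k n} → Echelon v X → Echelon w Y →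
    wt v ≡ k → wt w ≡ k → 2 * δ ≤ dH v w → MeetCodim≥ X Y δ
  MeetCodim≥-distinctVectors {n} {k} {δ} {v} {w} {X} {Y} EX EY wt-v wt-w 2δ≤dH {c} u indep-u u∈X u∈Y =
    ℕ.≤-trans (ℕ.+-monoˡ-≤ δ (LinIndep⇒≤ β indep-β)) (commonOnes+δ≤k v w wt-v wt-w 2δ≤dH)
    where
    S : Fin n → Bool
    S j = v j ∧ w j
    β : Fin c → Vec (count S)
    β i = u i ∘ select S
    a b : Fin c → Vec k
    a = proj₁ ∘ u∈X
    b = proj₁ ∘ u∈Y
    indep-β : LinIndep β
    indep-β α αβ≡0 = indep-u α (lincomb-zeroCoefficients a X u (proj₂ ∘ u∈X) α αa≡0)
      where
      common≡0 : ∀ j → v j ≡ true → w j ≡ true → lincomb α u j ≡ 0#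
      common≡0 j vj wj with select-surjective S j (cong₂ _∧_ vj wj)
      ... | t , refl = trans (lincomb-∘ α u (select S) t) (αβ≡0 t)
      αa≡0 : ∀ r → lincomb α a r ≡ 0#
      αa≡0 = commonZero⇒coefficients≡0 EX EY (lincomb α a) (lincomb α b) (lincomb α u)
        (λ j → sym (lincomb-coefficients a X u (proj₂ ∘ u∈X) α j))
        (λ j → sym (lincomb-coefficients b Y u (proj₂ ∘ u∈Y) α j)) common≡0

  module Lifting {n k : ℕ} (k≤n : k ≤ n) where
    N : ℕ
    N = n ∸ k

    N+k≡n : N + k ≡ n
    N+k≡n = ℕ.m∸n+n≡m k≤n

    Lift : Matrix k N → Matrix k n
    Lift D r = (D r ++ I r) ∘ cast (sym N+k≡n)

    colL : Fin N → Fin n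
    colL t = cast N+k≡n (t ↑ˡ k)

    colR : Fin k → Fin n
    colR r = cast N+k≡n (N ↑ʳ r)

    lincomb-Lift-colL : ∀ a D t → lincomb a (Lift D) (colL t) ≡ lincomb a D t
    lincomb-Lift-colL a D t = lincomb-cong (λ _ → refl) λ r →
      trans (cong (D r ++ I r) (Fin.cast-involutive (sym N+k≡n) N+k≡n (t ↑ˡ k)))
            (Vector.lookup-++ˡ (D r) (I r) t)

    Lift-pivots : ∀ D → Pivots (Lift D) colR
    Lift-pivots D r r′ =
      trans (cong (D r′ ++ I r′) (Fin.cast-involutive (sym N+k≡n) N+k≡n (N ↑ʳ r)))
            (Vector.lookup-++ʳ (D r′) (I r′) r)

    colL-onto : ∀ j → toℕ j < N → ∃ λ t → colL t ≡ j
    colL-onto j j<N = fromℕ< j<N , Fin.toℕ-injective (begin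
      toℕ (colL (fromℕ< j<N))       ≡⟨ Fin.toℕ-cast N+k≡n _ ⟩
      toℕ (fromℕ< j<N ↑ˡ k)         ≡⟨ Fin.toℕ-↑ˡ _ k ⟩
      toℕ (fromℕ< j<N)              ≡⟨ Fin.toℕ-fromℕ< j<N ⟩
      toℕ j                         ∎)
      where open ≡-Reasoning

    MeetCodim≥-lifted : ∀ {δ} (D₁ D₂ : Matrix k N) → RankAtLeast (D₁ -M D₂) δ →
      MeetCodim≥ (Lift D₁) (Lift D₂) δ
    MeetCodim≥-lifted D₁ D₂ rank =
      MeetCodim≥-samePivots (Lift-pivots D₁) (Lift-pivots D₂) (D₁ -M D₂) rank λ a aL₁≈aL₂ →
        lincomb-−M≡0 a D₁ D₂ λ t →
          trans (sym (lincomb-Lift-colL a D₁ t)) (trans (aL₁≈aL₂ (colL t)) (lincomb-Lift-colL a D₂ t))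

    rightOnes : BVec n → Fin n → Bool
    rightOnes v j = v j ∧ not (toℕ j <ᵇ N)

    meetWithLift≤ : ∀ {v : BVec n} {X : Matrix k n} {ρ c} → Echelon v X → (D : Matrix k N) → HasRank D ρ →
      (u : Fin c → Vec n) → LinIndep u → (∀ i → InSpan X (u i)) → (∀ i → InSpan (Lift D) (u i)) →
      c ≤ count (rightOnes v) + ρ
    meetWithLift≤ {v} {ρ = ρ} {c} EX D (B , _ , B≡rows) u indep-u u∈X u∈L = LinIndep⇒≤ β indep-β
      where
      module EX = Echelon EX
      R : Fin n → Bool
      R = rightOnes v
      left∈rowsD : ∀ i → InSpan B (u i ∘ colL)
      left∈rowsD i = proj₁ (B≡rows _)
        (proj₁ (u∈L i) , λ t → trans (sym (lincomb-Lift-colL _ D t)) (proj₂ (u∈L i) (colL t)))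
      γ : Fin c → Vec ρ
      γ = proj₁ ∘ left∈rowsD
      β : Fin c → Vec (count R + ρ)
      β i = (u i ∘ select R) ++ γ i
      indep-β : LinIndep β
      indep-β α αβ≡0 = indep-u α (Pivots-vanishing EX.pivots (proj₂ ∘ u∈X) α onPivots)
        where
        onR : ∀ t → lincomb α u (select R t) ≡ 0#
        onR t = trans (lincomb-∘ α u (select R) t)
          (trans (lincomb-cong (λ _ → refl) (λ i → sym (Vector.lookup-++ˡ (u i ∘ select R) (γ i) t)))
                 (αβ≡0 (t ↑ˡ ρ)))
        αγ≡0 : ∀ t → lincomb α γ t ≡ 0#
        αγ≡0 t = trans (lincomb-cong (λ _ → refl) (λ i → sym (Vector.lookup-++ʳ (u i ∘ select R) (γ i) t)))
                       (αβ≡0 (count R ↑ʳ t))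
        onLeft : ∀ t → lincomb α u (colL t) ≡ 0#
        onLeft t = trans (lincomb-∘ α u colL t)
          (lincomb-zeroCoefficients γ B (λ i → u i ∘ colL) (proj₂ ∘ left∈rowsD) α αγ≡0 t)
        onPivots : ∀ r → lincomb α u (EX.piv r) ≡ 0#
        onPivots r with toℕ (EX.piv r) ℕ.<? N
        ... | yes left = let t , colL-t≡piv = colL-onto _ left in
          subst (λ j → lincomb α u j ≡ 0#) colL-t≡piv (onLeft t)
        ... | no ¬left = let t , select-t≡piv = select-surjective R (EX.piv r) piv∈R in
          subst (λ j → lincomb α u j ≡ 0#) select-t≡piv (onR t)
          where
          piv∈R : R (EX.piv r) ≡ true
          piv∈R = cong₂ _∧_ (EX.piv-one r) (cong not (≮⇒<ᵇ≡false _ N ¬left))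

    MeetCodim≥-mixed : ∀ {s δ} {v : BVec n} {X : Matrix k n} → Echelon v X → wt v ≡ k →
      s ≤ onesBefore v N → δ ≤ s → (D : Matrix k N) → RankIn D 0 (s ∸ δ) → MeetCodim≥ X (Lift D) δ
    MeetCodim≥-mixed {s} {δ} {v} EX wt-v s≤ones δ≤s D (ρ , rank-D , _ , ρ≤s∸δ) {c} u indep-u u∈X u∈L = begin
      c + δ                   ≤⟨ ℕ.+-monoˡ-≤ δ (meetWithLift≤ EX D rank-D u indep-u u∈X u∈L) ⟩
      (R + ρ) + δ             ≤⟨ ℕ.+-monoˡ-≤ δ (ℕ.+-monoʳ-≤ R ρ≤s∸δ) ⟩
      (R + (s ∸ δ)) + δ       ≡⟨ trans (ℕ.+-assoc R _ δ) (cong (R +_) (ℕ.m∸n+n≡m δ≤s)) ⟩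
      R + s                   ≤⟨ ℕ.+-monoʳ-≤ R s≤ones ⟩
      R + onesBefore v N      ≡⟨ trans (sym (wt≡onesFrom+onesBefore v N)) wt-v ⟩
      k                       ∎
      where
      open ℕ.≤-Reasoning
      R : ℕ
      R = count (rightOnes v)

  FerrersCode-difference : ∀ {n k m δ} {v : BVec n} (C : FerrersCode {n} {k} v m δ) {l l′} → l ≢ l′ →
    let open FerrersCode C in
    Σ (Fin m) λ l″ → word l″ ≈M (word l -M word l′) × RankAtLeast (word l″) δ
  FerrersCode-difference {m = m} C {l} {l′} l≢l′ = l″ , l″≈l-l′ , minRank l″ l″≢0
    where
    open FerrersCode C
    -l′ l″ : Fin m
    -l′ = proj₁ (closed-· (-ᶠ 1#) l′)
    l″ = proj₁ (closed-+ l -l′)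
    l″≈l-l′ : word l″ ≈M (word l -M word l′)
    l″≈l-l′ r j = trans (proj₂ (closed-+ l -l′) r j)
      (cong (word l r j +ᶠ_) (trans (proj₂ (closed-· (-ᶠ 1#) l′) r j) (-1*x≈-x _)))
    l″≢0 : ¬ (word l″ ≈M zeroM)
    l″≢0 l″≈0 = distinct l l′ l≢l′ λ r j → x∙y⁻¹≈ε⇒x≈y _ _ (trans (sym (l″≈l-l′ r j)) (l″≈0 r j))

  module _ {n k δ s M₁ M₂ : ℕ} (k≤n : k ≤ n) (δ≤s : δ ≤ s)
           (ML : MultilevelCDC n M₁ δ k s) (G : GRMC k (n ∸ k) M₂ δ 0 (s ∸ δ)) where
    open MultilevelCDC ML
    open Lifting k≤n

    private
      D : Fin M₂ → Matrix k N
      D = proj₁ G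

      Index : Set
      Index = Σ (Fin a) (Fin ∘ size)

      index : Fin M₁ → Index
      index m = unflatten size (cast total m)

      index-injective : ∀ {m m′} → index m ≡ index m′ → m ≡ m′
      index-injective {m} {m′} eq = begin
        m                                ≡⟨ Fin.cast-involutive (sym total) total m ⟨
        cast (sym total) (cast total m)  ≡⟨ cong (cast (sym total)) (unflatten-injective size eq) ⟩
        cast (sym total) (cast total m′) ≡⟨ Fin.cast-involutive (sym total) total m′ ⟩
        m′                               ∎
        where open ≡-Reasoning

      multilevelWord : Index → Matrix k n
      multilevelWord (i , l) = filled i l

      echelon : ((i , l) : Index) → Echelon (idVec i) (multilevelWord (i , l))
      echelon (i , l) = EF-echelon (idVec i) (weight i) _ (FerrersCode.supported (code i) l)

      multilevel-codim : ∀ p p′ → p ≢ p′ → MeetCodim≥ (multilevelWord p) (multilevelWord p′) δ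
      multilevel-codim (i , l) (i′ , l′) p≢p′ with i Fin.≟ i′
      ... | no i≢i′ =
        MeetCodim≥-distinctVectors (echelon (i , l)) (echelon (i′ , l′))
          (weight i) (weight i′) (hamming i i′ i≢i′)
      ... | yes refl =
        let l″ , l″≈l-l′ , rank = FerrersCode-difference (code i) (p≢p′ ∘ cong (i ,_)) in
        MeetCodim≥-sameVector (idVec i) (weight i) _ _ _
          (FerrersCode.supported (code i) l) (FerrersCode.supported (code i) l′) l″≈l-l′ rank

      codeword : Fin M₁ ⊎ Fin M₂ → Matrix k n
      codeword (inj₁ m) = multilevelWord (index m)
      codeword (inj₂ g) = Lift (D g)

      codeword-indep : ∀ x → LinIndep (codeword x)
      codeword-indep (inj₁ m) = Pivots⇒LinIndep (Echelon.pivots (echelon (index m)))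
      codeword-indep (inj₂ g) = Pivots⇒LinIndep (Lift-pivots (D g))

      codeword-codim : ∀ x y → x ≢ y → MeetCodim≥ (codeword x) (codeword y) δ
      codeword-codim (inj₁ m) (inj₁ m′) x≢y =
        multilevel-codim (index m) (index m′) (x≢y ∘ cong inj₁ ∘ index-injective)
      codeword-codim (inj₁ m) (inj₂ g)  _   = let i , _ = index m in
        MeetCodim≥-mixed (echelon (index m)) (weight i) (prefixWt i) δ≤s (D g) (proj₁ (proj₂ G) g)
      codeword-codim (inj₂ g) (inj₁ m)  _   = MeetCodim≥-sym (codeword-codim (inj₁ m) (inj₂ g) λ ())
      codeword-codim (inj₂ g) (inj₂ g′) x≢y =
        MeetCodim≥-lifted (D g) (D g′) (proj₂ (proj₂ G) g g′ (x≢y ∘ cong inj₂))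

      splitAt-injective : ∀ {x y} → splitAt M₁ {M₂} x ≡ splitAt M₁ y → x ≡ y
      splitAt-injective {x} {y} eq =
        trans (sym (Fin.join-splitAt M₁ M₂ x)) (trans (cong (join M₁ M₂) eq) (Fin.join-splitAt M₁ M₂ y))

    multilevel+lifted : CDC n (M₁ + M₂) (2 * δ) k
    multilevel+lifted =
      (λ x → RowSpace (codeword (splitAt M₁ x))) ,
      (λ x → LinIndep⇒HasRank _ (codeword-indep (splitAt M₁ x))) ,
      (λ x y x≢y → MeetCodim≥⇒dS≥ (codeword-indep (splitAt M₁ x)) (codeword-indep (splitAt M₁ y))
         (codeword-codim (splitAt M₁ x) (splitAt M₁ y) (x≢y ∘ splitAt-injective)))

mainTheorem6 : ∀ {q : ℕ} → IsPrimePower q → (F : FiniteField q) →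
    (n k δ s M₁ M₂ : ℕ) → 1 ≤ n → 1 ≤ k → 1 ≤ δ → 1 ≤ s →
    2 * k ≤ n → δ ≤ s →
    LinAlg.MultilevelCDC F n M₁ δ k s →
    LinAlg.GRMC F k (n ∸ k) M₂ δ 0 (s ∸ δ) →
    LinAlg.CDC F n (M₁ + M₂) (2 * δ) k
mainTheorem6 _ F n k δ s M₁ M₂ _ _ _ _ 2k≤n δ≤s ML G =
  multilevel+lifted F (ℕ.≤-trans (ℕ.m≤n*m k 2) 2k≤n) δ≤s ML G
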